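{- Let $(T,M,P,B)$ be a WORMS instance and let $\mathcal{T}(T,M,P,B)$ be the associated instance of $P|outtree,p_j=1|\sum wC$. For every feasible schedule $\sigma$ of $\mathcal{T}(T,M,P,B)$ there exists an overfilling schedule $S'$ for $(T,M,P,B)$ with $c(S')=cost(\sigma)$.
   Context: WORMS instance $(T,M,P,B)$. - $T$ is a finite rooted tree. For a node $v$, $h(v)$ is the number of edges from the root to $v$, and $h=\max_v h(v)$. All leaves have $h(v)=h$. - $M$ is a finite set of messages, each with a target leaf. - $P$ and $B$ are positive integers. All messages start at the root before time step $1$. Schedules. A schedule is a sequence of time steps, each with at most $P$ flushes. A flush consists of an edge $(v,v')$, with $v'$ a child of $v$, and a set $M_f$ of at most $B$ messages. It is valid at step $t$ if all of $M_f$ is in $v$ at step $t$ and $M_f$ is disjoint from the message sets of the other flushes at step $t$. Flushed messages are in $v'$ at step $t+1$; other messages stay put. A schedule is overfilling if all flushes are valid and every message is eventually flushed into its target leaf. $c(S,m)$ is the time step of the flush moving $m$ into its target leaf, and $c(S)=\sum_m c(S,m)$. Scheduling problem. An instance of $P|outtree,p_j=1|\sum wC$ consists of tasks with nonnegative weights, each task having at most one parent, with no cycles in the parent relation. A feasible schedule processes every task exactly once, at most $P$ tasks per time step, each task strictly after its parent. $cost(\sigma)=\sum_j w(j)c(\sigma,j)$, where $c(\sigma,j)$ is the step at which $j$ is processed. Packed nodes. Process heights $h'=h,h-1,\dots,1$ and, for each node $v$ with $h(v)=h'$, let $C(v)$ be the set of messages whose target leaf is a descendant of $v$ (where $v$ counts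 as its own descendant) and which do not lie in $C(v')$ for any packed node $v'$ with $h(v')>h'$. Then $v$ is a packed node if $|C(v)|\ge B/6$, and $C(v)$ is its packed contents. The root is also a packed node, and its packed contents are all messages not in the packed contents of another packed node. Oblivious packed sets. - For each internal packed node $v$, partition the children of $v$ arbitrarily into groups such that, for each group, the number of messages of $C(v)$ whose target leaf is a descendant of some child in the group is between $B/6$ and $B/2$. Each group yields an oblivious packed set: the messages of $C(v)$ below that group. - For each packed node $v$ that is a leaf, partition $C(v)$ arbitrarily into sets of size between $B/6$ and $B/2$. In both cases $v$ is the packed parent of the set. The instance $\mathcal{T}(T,M,P,B)$ has $P$ machines. For each oblivious packed set $C$ with packed parent $v$: - Create a chain of $h(v)$ tasks, one for each edge on the root-to-$v$ path. The first has no parent and each other has the previous one as parent. All have weight $0$, except as specified below. - If $v$ is internal, create one task for each edge of $T$ below the children in $C$'s group (including the edges from $v$ to those children). The parent of each such task is the task for the edge immediately above it, and the task for an edge from $v$ has the last chain task as parent. A task for the edge into a leaf $\ell$ has weight equal to the number of messages with target leaf $\ell$; all other such tasks have weight $0$. - If $v$ is a leaf, the last task of the chain has weight $|C|$. Each task thus corresponds to a pair (oblivious packed set, edge of $T$). -}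

module Defs where

open import Data.Nat using (ℕ; zero; suc; _+_; _*_; _∸_; _≤_; _<_; _≡ᵇ_)
open import Data.Bool using (Bool; true; false; _∧_; _∨_; not; if_then_else_; T)
open import Data.Fin using (Fin; toℕ; _≟_)
open import Data.List using (List; []; _∷_; length; map; allFin; concatMap)
open import Data.Nat.ListAction using (sum)
open import Data.Bool.ListAction using (any)
import Data.List.Membership.DecPropositional as DecMem
open import Data.List.Relation.Unary.All using (All)
open import Data.List.Relation.Unary.Any using (Any)
open import Data.List.Relation.Unary.Unique.Propositional using (Unique)
open import Data.List.Membership.Propositional using (_∈_)
open import Data.Product using (Σ; ∃; _×_; _,_; proj₁; proj₂)
open import Data.Unit using (⊤)
open import Data.Empty using (⊥)
open import Function using (_∘_; _⇔_)
open import Relation.Nullary using (¬_; ⌊_⌋)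
open import Relation.Binary.PropositionalEquality using (_≡_; _≢_)

sumFin : {n : ℕ} → (Fin n → ℕ) → ℕ
sumFin {n} f = sum (map f (allFin n))

count : {n : ℕ} → (Fin n → Bool) → ℕ
count f = sumFin (λ x → if f x then 1 else 0)

anyFin : {n : ℕ} → (Fin n → Bool) → Bool
anyFin {n} f = any f (allFin n)

iterate : {A : Set} → (A → A) → ℕ → A → A
iterate f zero a = a
iterate f (suc k) a = f (iterate f k a)

-- The non-root nodes v are exactly the
-- children of par v; the edge (par v, v) is identified with v.

record RootedTree : Set where
  field
    N      : ℕ
    root   : Fin N
    par    : Fin N → Fin N
    ht     : Fin N → ℕ
    par-root : par root ≡ root
    ht-root  : ht root ≡ 0
    ht-par   : ∀ v → v ≢ root → ht v ≡ suc (ht (par v))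

  -- u is a descendant of v (v counts as its own descendant)
  desc : Fin N → Fin N → Bool
  desc u v = anyFin {suc (ht u)} (λ k → ⌊ iterate par (toℕ k) u ≟ v ⌋)

  isRoot : Fin N → Bool
  isRoot v = ⌊ v ≟ root ⌋

  isLeaf : Fin N → Bool
  isLeaf v = not (anyFin (λ u → not (isRoot u) ∧ ⌊ par u ≟ v ⌋))

record WORMS : Set where
  field
    tree : RootedTree
  open RootedTree tree public
  field
    leaves-same-height : ∀ l l' → isLeaf l ≡ true → isLeaf l' ≡ true → ht l ≡ ht l'
    -- non-degeneracy: the tree has at least one edge (h ≥ 1)
    root-not-leaf : isLeaf root ≡ false
    m      : ℕ
    target : Fin m → Fin N
    target-leaf : ∀ x → isLeaf (target x) ≡ true
    P      : ℕ
    B      : ℕ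
    P-pos  : 1 ≤ P
    B-pos  : 1 ≤ B

module _ (I : WORMS) where
  open WORMS I
  open DecMem (_≟_ {m}) using (_∈?_)

  -- Schedules.  A flush is (v' , M_f): the edge (par v', v') and a list of
  -- messages.  A schedule is a list of time steps (step 1 first).

  Flush : Set
  Flush = Fin N × List (Fin m)

  Schedule : Set
  Schedule = List (List Flush)

  move : List Flush → (Fin m → Fin N) → Fin m → Fin N
  move [] st x = st x
  move ((v' , ms) ∷ fs) st x = if ⌊ x ∈? ms ⌋ then v' else move fs st x

  StepValid : (Fin m → Fin N) → List Flush → Set
  StepValid st fs =
    length fs ≤ P ×
    Unique (concatMap proj₂ fs) ×
    All (λ f → proj₁ f ≢ root × length (proj₂ f) ≤ B ×
               All (λ x → st x ≡ par (proj₁ f)) (proj₂ f)) fs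

  ValidFrom : (Fin m → Fin N) → Schedule → Set
  ValidFrom st [] = ⊤
  ValidFrom st (fs ∷ S) = StepValid st fs × ValidFrom (move fs st) S

  Valid : Schedule → Set
  Valid S = ValidFrom (λ _ → root) S

  -- FlushedIntoTarget S x t : at time step t (t ≥ 1) some flush of S moves
  -- x into its target leaf
  FlushedIntoTarget : Schedule → Fin m → ℕ → Set
  FlushedIntoTarget [] x t = ⊥
  FlushedIntoTarget (fs ∷ S) x zero = ⊥
  FlushedIntoTarget (fs ∷ S) x (suc zero) =
    Any (λ f → x ∈ proj₂ f × proj₁ f ≡ target x) fs
  FlushedIntoTarget (fs ∷ S) x (suc (suc t)) = FlushedIntoTarget S x (suc t)

  Overfilling : Schedule → Set
  Overfilling S = Valid S × (∀ x → ∃ λ t → FlushedIntoTarget S x t)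

  -- c(S) = n : there are completion times c(S,x) with sum n
  -- (in a valid schedule the completion time of a message is unique)
  ScheduleCost : Schedule → ℕ → Set
  ScheduleCost S n =
    Σ (Fin m → ℕ) λ c → (∀ x → FlushedIntoTarget S x (c x)) × sumFin c ≡ n

  record Packing : Set where
    field
      pk : Fin N → Bool
      C  : Fin N → Fin m → Bool
      C-spec : ∀ v → v ≢ root → ∀ x →
        (C v x ≡ true) ⇔
        (desc (target x) v ≡ true ×
         ¬ (∃ λ w → pk w ≡ true × ht v < ht w × C w x ≡ true))
      pk-spec : ∀ v → v ≢ root → (pk v ≡ true) ⇔ (B ≤ 6 * count (C v))
      pk-root : pk root ≡ true
      C-root : ∀ x →
        (C root x ≡ true) ⇔
        (¬ (∃ λ w → w ≢ root × pk w ≡ true × C w x ≡ true))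

  module _ (Pk : Packing) where
    open Packing Pk

    -- If pv k is internal, the set is given by a group grp k of children
    -- of pv k; if pv k is a leaf, it is given by the subset lset k of C(pv k).

    record Oblivious : Set where
      field
        K   : ℕ
        pv  : Fin K → Fin N
        grp : Fin K → Fin N → Bool
        lset : Fin K → Fin m → Bool

      member : Fin K → Fin m → Bool
      member k x = if isLeaf (pv k) then lset k x
                   else (C (pv k) x ∧ anyFin (λ c → grp k c ∧ desc (target x) c))

      field
        pv-packed : ∀ k → pk (pv k) ≡ true
        grp-children : ∀ k → isLeaf (pv k) ≡ false → ∀ c → grp k c ≡ true →
                       c ≢ root × par c ≡ pv k
        grp-partition : ∀ v → pk v ≡ true → isLeaf v ≡ false →
          ∀ c → c ≢ root → par c ≡ v →
          (∃ λ k → pv k ≡ v × grp k c ≡ true) ×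
          (∀ k k' → pv k ≡ v → grp k c ≡ true → pv k' ≡ v → grp k' c ≡ true → k ≡ k')
        lset-sub : ∀ k → isLeaf (pv k) ≡ true → ∀ x → lset k x ≡ true → C (pv k) x ≡ true
        lset-partition : ∀ v → pk v ≡ true → isLeaf v ≡ true →
          ∀ x → C v x ≡ true →
          (∃ λ k → pv k ≡ v × lset k x ≡ true) ×
          (∀ k k' → pv k ≡ v → lset k x ≡ true → pv k' ≡ v → lset k' x ≡ true → k ≡ k')
        size-lower : ∀ k → B ≤ 6 * count (member k)
        size-upper : ∀ k → 2 * count (member k) ≤ B

      -- The instance 𝒯(T,M,P,B): task (k , e) for oblivious set k and edge
      -- (par e , e).  Parent of task (k , e) is (k , par e) when par e ≠ root.

      isTask : Fin K → Fin N → Bool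
      isTask k e = not (isRoot e) ∧
        (desc (pv k) e ∨
         (not (isLeaf (pv k)) ∧ anyFin (λ c → grp k c ∧ desc e c)))

      weight : Fin K → Fin N → ℕ
      weight k e =
        if isLeaf (pv k)
        then (if ⌊ e ≟ pv k ⌋ then count (member k) else 0)
        else (if isLeaf e then count (λ x → member k x ∧ ⌊ target x ≟ e ⌋) else 0)

      Feasible : (Fin K → Fin N → ℕ) → Set
      Feasible σ =
        (∀ k e → isTask k e ≡ true → 1 ≤ σ k e) ×
        (∀ k e → isTask k e ≡ true → par e ≢ root → σ k (par e) < σ k e) ×
        (∀ t → sumFin (λ k → count (λ e → isTask k e ∧ (σ k e ≡ᵇ t))) ≤ P)

      cost : (Fin K → Fin N → ℕ) → ℕ
      cost σ = sumFin (λ k → sumFin (λ e →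
                 if isTask k e then weight k e * σ k e else 0))

{-# OPTIONS --safe #-}
-- Every message x lies in exactly one oblivious packed set k(x), and the tasks of k(x) include
-- all edges on the path from the root to the target of x.  Read σ as a schedule: at step t, for
-- every task (k , e) that σ processes at t, flush the edge e carrying all messages of k whose
-- target lies below e.  Because σ respects the precedence constraints, the path tasks of k(x)
-- are processed at strictly increasing times, so at every step x sits at the upper end of the
-- one flush that carries it (if any), and it enters its target at step σ(k(x), target x).
-- A flush holds at most |k| ≤ B / 2 messages, a step holds at most P flushes, and since the
-- weight of (k , e) counts the messages of k targeted at e, the total completion time is
-- Σ_x σ(k(x), target x) = cost σ.
module Submission where

open import Defs
open import Data.Bool using (Bool; true; false; _∧_; not; if_then_else_; T)
open import Data.Bool.Properties using (T-≡; T-∧; ∨-zeroʳ)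
import Data.Bool.Properties as Bool
open import Data.Fin using (Fin; zero; suc; toℕ; fromℕ<; punchIn; _≟_)
open import Data.Fin.Properties using (toℕ<n; toℕ-fromℕ<; punchInᵢ≢i; any?)
open import Data.List
  using (List; []; _∷_; _++_; concat; length; map; tabulate; allFin; concatMap; filterᵇ; cartesianProduct)
open import Data.List.Properties using (map-++; map-∘; map-cong; length-map)
open import Data.List.Membership.Propositional using (_∈_; lose; find)
open import Data.List.Membership.Propositional.Properties
  using (∈-allFin; ∈-concatMap⁻; ∈-filter⁺; ∈-filter⁻; ∈-cartesianProduct⁺; ∈-map⁺; ∈-map⁻)
import Data.List.Membership.DecPropositional as DecMembership
open import Data.List.Relation.Binary.Disjoint.Propositional using (Disjoint)
open import Data.List.Relation.Binary.Sublist.Propositional using (⊆-refl)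
import Data.List.Relation.Binary.Sublist.Propositional.Properties as Sublist
open Sublist using (length-mono-≤)
open import Data.List.Relation.Unary.All as All using (All)
open import Data.List.Relation.Unary.All.Properties using (map⁺)
open import Data.List.Relation.Unary.Any using (Any; here; there; satisfied)
open import Data.List.Relation.Unary.Any.Properties using (any⁺; any⁻)
open import Data.List.Relation.Unary.Unique.Propositional using (Unique; []; _∷_)
open import Data.List.Relation.Unary.Unique.Propositional.Properties
  using (++⁺; filter⁺; cartesianProduct⁺; allFin⁺)
open import Data.Nat
  using (ℕ; zero; suc; pred; _+_; _*_; _∸_; _≤_; _<_; _≡ᵇ_; _≤?_; _<?_; z≤n; s≤s; s≤s⁻¹)
open import Data.Nat.ListAction using (sum)
open import Data.Nat.ListAction.Properties using (sum-++)
open import Data.Nat.Properties hiding (_≟_)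
open import Data.Nat.Properties using () renaming (_≟_ to _≟ℕ_)
open import Algebra.Properties.Semiring.Sum +-*-semiring
  using (sum-syntax; sum-cong-≗; sum-remove; sum-replicate-zero; ∑-comm; *-distribʳ-sum)
  renaming (sum to ∑)
open import Data.Product using (∃; _×_; _,_; proj₁; proj₂; map₂)
open import Data.Sum using (inj₁; inj₂)
open import Function using (_∘_; id)
open import Function.Bundles using (Equivalence)
open import Relation.Binary using (tri<; tri≈; tri>)
open import Relation.Binary.PropositionalEquality
open import Relation.Nullary using (¬_; ⌊_⌋; yes; no; contradiction)
open import Relation.Nullary.Decidable using (toWitness; ¬?; _×-dec_; T?)

open Equivalence using (to; from)

∧-true⁻ : ∀ {a b} → a ∧ b ≡ true → a ≡ true × b ≡ true
∧-true⁻ {true} b≡true = refl , b≡true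

module _ {n : ℕ} where

  ≟-refl : (a : Fin n) → ⌊ a ≟ a ⌋ ≡ true
  ≟-refl a = cong ⌊_⌋ (≡-≟-identity _≟_ refl)

  ≟-≢ : {a b : Fin n} → a ≢ b → ⌊ a ≟ b ⌋ ≡ false
  ≟-≢ a≢b = cong ⌊_⌋ (≢-≟-identity _≟_ a≢b)

  ≟-true⁻ : {a b : Fin n} → ⌊ a ≟ b ⌋ ≡ true → a ≡ b
  ≟-true⁻ {a} {b} eq = toWitness {a? = a ≟ b} (from T-≡ eq)

  anyFin⁺ : (f : Fin n → Bool) (i : Fin n) → f i ≡ true → anyFin f ≡ true
  anyFin⁺ f i fi = to T-≡ (any⁺ f (lose (∈-allFin i) (from T-≡ fi)))

  anyFin⁻ : (f : Fin n → Bool) → anyFin f ≡ true → ∃ λ i → f i ≡ true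
  anyFin⁻ f e = map₂ (to T-≡) (satisfied (any⁻ f (allFin n) (from T-≡ e)))

sum-map-tabulate : ∀ {A : Set} {n} (f : A → ℕ) (g : Fin n → A) →
                   sum (map f (tabulate g)) ≡ ∑[ i < n ] f (g i)
sum-map-tabulate {n = zero}  f g = refl
sum-map-tabulate {n = suc n} f g = cong (f (g zero) +_) (sum-map-tabulate f (g ∘ suc))

sumFin≡∑ : ∀ {n} (f : Fin n → ℕ) → sumFin f ≡ ∑[ i < n ] f i
sumFin≡∑ f = sum-map-tabulate f id

≤-sumFin : ∀ {n} (f : Fin n → ℕ) (i : Fin n) → f i ≤ sumFin f
≤-sumFin {suc n} f i = begin
  f i                              ≤⟨ m≤m+n (f i) _ ⟩
  f i + ∑[ j < n ] f (punchIn i j) ≡⟨ sum-remove f ⟨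
  ∑[ j < suc n ] f j               ≡⟨ sumFin≡∑ f ⟨
  sumFin f                         ∎
  where open ≤-Reasoning

∑-single : ∀ {n} (f : Fin n → ℕ) (a : Fin n) → (∀ i → i ≢ a → f i ≡ 0) →
           ∑[ i < n ] f i ≡ f a
∑-single {suc n} f a vanish = begin
  ∑[ i < suc n ] f i               ≡⟨ sum-remove f ⟩
  f a + ∑[ j < n ] f (punchIn a j) ≡⟨ cong (f a +_) (sum-cong-≗ λ j → vanish (punchIn a j) (punchInᵢ≢i a j)) ⟩
  f a + ∑[ j < n ] 0               ≡⟨ cong (f a +_) (sum-replicate-zero n) ⟩
  f a + 0                          ≡⟨ +-identityʳ (f a) ⟩
  f a                              ∎
  where open ≡-Reasoning

module _ {n : ℕ} {p q : Fin n → Bool} where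

  count-cong : (∀ i → p i ≡ q i) → count p ≡ count q
  count-cong p≗q = cong sum (map-cong (λ i → cong (λ b → if b then 1 else 0) (p≗q i)) (allFin n))

count-none : ∀ {n} (p : Fin n → Bool) → (∀ i → p i ≡ false) → count p ≡ 0
count-none {n} p none = begin
  count p                           ≡⟨ sumFin≡∑ (λ i → if p i then 1 else 0) ⟩
  ∑[ i < n ] (if p i then 1 else 0) ≡⟨ sum-cong-≗ (λ i → cong (λ b → if b then 1 else 0) (none i)) ⟩
  ∑[ i < n ] 0                      ≡⟨ sum-replicate-zero n ⟩
  0                                 ∎
  where open ≡-Reasoning

module _ {A : Set} where

  length-filterᵇ : (p : A → Bool) (xs : List A) →
                   length (filterᵇ p xs) ≡ sum (map (λ x → if p x then 1 else 0) xs)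
  length-filterᵇ p [] = refl
  length-filterᵇ p (x ∷ xs) with p x
  ... | true  = cong suc (length-filterᵇ p xs)
  ... | false = length-filterᵇ p xs

  module _ {B : Set} where

    sum-map-cartesianProduct : (h : A × B → ℕ) (xs : List A) (ys : List B) →
      sum (map h (cartesianProduct xs ys)) ≡ sum (map (λ x → sum (map (λ y → h (x , y)) ys)) xs)
    sum-map-cartesianProduct h [] ys = refl
    sum-map-cartesianProduct h (x ∷ xs) ys = begin
      sum (map h (map (x ,_) ys ++ cartesianProduct xs ys))
        ≡⟨ cong sum (map-++ h (map (x ,_) ys) _) ⟩
      sum (map h (map (x ,_) ys) ++ map h (cartesianProduct xs ys))
        ≡⟨ sum-++ (map h (map (x ,_) ys)) _ ⟩
      sum (map h (map (x ,_) ys)) + sum (map h (cartesianProduct xs ys))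
        ≡⟨ cong₂ _+_ (cong sum (sym (map-∘ ys))) (sum-map-cartesianProduct h xs ys) ⟩
      sum (map (λ y → h (x , y)) ys) + sum (map (λ x → sum (map (λ y → h (x , y)) ys)) xs) ∎
      where open ≡-Reasoning

    concatMap-unique : (g : A → List B) {xs : List A} → Unique xs →
      (∀ {a} → a ∈ xs → Unique (g a)) →
      (∀ {a b y} → a ∈ xs → b ∈ xs → y ∈ g a → y ∈ g b → a ≡ b) →
      Unique (concatMap g xs)
    concatMap-unique g {[]} [] _ _ = []
    concatMap-unique g {a ∷ xs} (a∉xs ∷ xs!) g! owner =
      ++⁺ (g! (here refl)) (concatMap-unique g xs! (g! ∘ there) (λ a b → owner (there a) (there b)))
          disjoint
      where
        disjoint : Disjoint (g a) (concatMap g xs)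
        disjoint (y∈ga , y∈rest) with find (∈-concatMap⁻ g y∈rest)
        ... | b , b∈xs , y∈gb = All.lookup a∉xs b∈xs (owner (here refl) (there b∈xs) y∈ga y∈gb)

count-pairs : ∀ {K N} (p : Fin K → Fin N → Bool) →
  length (filterᵇ (λ (k , e) → p k e) (cartesianProduct (allFin K) (allFin N)))
  ≡ sumFin (λ k → count (p k))
count-pairs {K} {N} p = trans (length-filterᵇ _ (cartesianProduct (allFin K) (allFin N)))
                              (sum-map-cartesianProduct _ (allFin K) (allFin N))

module TreeProperties (T : RootedTree) where
  open RootedTree T

  ht≡0⇒root : ∀ {v} → ht v ≡ 0 → v ≡ root
  ht≡0⇒root {v} ht≡0 with v ≟ root
  ... | yes v≡root = v≡root
  ... | no  v≢root = contradiction (trans (sym (ht-par v v≢root)) ht≡0) λ ()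

  nonroot⇒ht>0 : ∀ {v} → v ≢ root → 0 < ht v
  nonroot⇒ht>0 {v} v≢root rewrite ht-par v v≢root = s≤s z≤n

  ht-par-pred : ∀ v → ht (par v) ≡ pred (ht v)
  ht-par-pred v with v ≟ root
  ... | yes refl rewrite par-root | ht-root = refl
  ... | no  v≢root = cong pred (sym (ht-par v v≢root))

  ht-iterate-par : ∀ i v → ht (iterate par i v) ≡ ht v ∸ i
  ht-iterate-par zero    v = refl
  ht-iterate-par (suc i) v = begin
    ht (par (iterate par i v))  ≡⟨ ht-par-pred (iterate par i v) ⟩
    pred (ht (iterate par i v)) ≡⟨ cong pred (ht-iterate-par i v) ⟩
    pred (ht v ∸ i)             ≡⟨ pred[m∸n]≡m∸[1+n] (ht v) i ⟩
    ht v ∸ suc i                ∎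
    where open ≡-Reasoning

  iterate-par-+ : ∀ i j v → iterate par (i + j) v ≡ iterate par i (iterate par j v)
  iterate-par-+ zero    j v = refl
  iterate-par-+ (suc i) j v = cong par (iterate-par-+ i j v)

  anc : Fin N → ℕ → Fin N
  anc u d = iterate par (ht u ∸ d) u

  ht-anc : ∀ u {d} → d ≤ ht u → ht (anc u d) ≡ d
  ht-anc u {d} d≤ht = trans (ht-iterate-par (ht u ∸ d) u) (m∸[m∸n]≡n d≤ht)

  anc-zero : ∀ u → anc u 0 ≡ root
  anc-zero u = ht≡0⇒root (ht-anc u z≤n)

  anc-ht : ∀ u → anc u (ht u) ≡ u
  anc-ht u = cong (λ i → iterate par i u) (n∸n≡0 (ht u))

  anc-nonroot : ∀ u {d} → 0 < d → d ≤ ht u → anc u d ≢ root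
  anc-nonroot u {suc d} _ d≤ht anc≡root =
    contradiction (trans (sym (ht-anc u d≤ht)) (trans (cong ht anc≡root) ht-root)) λ ()

  par-anc : ∀ u {d} → d < ht u → par (anc u (suc d)) ≡ anc u d
  par-anc u {d} d<ht = cong (λ i → iterate par i u) (sym (+-∸-assoc 1 d<ht))

  anc-anc : ∀ u {d d'} → d' ≤ d → d ≤ ht u → anc (anc u d) d' ≡ anc u d'
  anc-anc u {d} {d'} d'≤d d≤ht = begin
    iterate par (ht (anc u d) ∸ d') (anc u d)
      ≡⟨ cong (λ h → iterate par (h ∸ d') (anc u d)) (ht-anc u d≤ht) ⟩
    iterate par (d ∸ d') (iterate par (ht u ∸ d) u)
      ≡⟨ iterate-par-+ (d ∸ d') (ht u ∸ d) u ⟨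
    iterate par ((d ∸ d') + (ht u ∸ d)) u
      ≡⟨ cong (λ i → iterate par i u) steps ⟩
    iterate par (ht u ∸ d') u ∎
    where
      open ≡-Reasoning
      steps : (d ∸ d') + (ht u ∸ d) ≡ ht u ∸ d'
      steps = begin
        (d ∸ d') + (ht u ∸ d) ≡⟨ +-comm (d ∸ d') _ ⟩
        (ht u ∸ d) + (d ∸ d') ≡⟨ +-∸-assoc (ht u ∸ d) d'≤d ⟨
        (ht u ∸ d + d) ∸ d'   ≡⟨ cong (_∸ d') (m∸n+n≡m d≤ht) ⟩
        ht u ∸ d'             ∎

  desc-anc : ∀ u {d} → d ≤ ht u → desc u (anc u d) ≡ true
  desc-anc u {d} d≤ht = anyFin⁺ _ (fromℕ< i<) (begin
    ⌊ iterate par (toℕ (fromℕ< i<)) u ≟ anc u d ⌋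
      ≡⟨ cong (λ i → ⌊ iterate par i u ≟ anc u d ⌋) (toℕ-fromℕ< i<) ⟩
    ⌊ anc u d ≟ anc u d ⌋
      ≡⟨ ≟-refl (anc u d) ⟩
    true ∎)
    where
      open ≡-Reasoning
      i< : ht u ∸ d < suc (ht u)
      i< = s≤s (m∸n≤m (ht u) d)

  desc⇒anc : ∀ {u v} → desc u v ≡ true → ht v ≤ ht u × anc u (ht v) ≡ v
  desc⇒anc {u} {v} u≤v with anyFin⁻ {suc (ht u)} _ u≤v
  ... | i , iterate≡v = subst (_≤ ht u) (sym ht-v) (m∸n≤m (ht u) j) , anc-v
    where
      j = toℕ i
      iter : iterate par j u ≡ v
      iter = ≟-true⁻ iterate≡v
      ht-v : ht v ≡ ht u ∸ j
      ht-v = trans (cong ht (sym iter)) (ht-iterate-par j u)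
      anc-v : anc u (ht v) ≡ v
      anc-v = begin
        iterate par (ht u ∸ ht v) u
          ≡⟨ cong (λ h → iterate par (ht u ∸ h) u) ht-v ⟩
        iterate par (ht u ∸ (ht u ∸ j)) u
          ≡⟨ cong (λ i → iterate par i u) (m∸[m∸n]≡n (s≤s⁻¹ (toℕ<n i))) ⟩
        iterate par j u
          ≡⟨ iter ⟩
        v ∎
        where open ≡-Reasoning

  desc-refl : ∀ u → desc u u ≡ true
  desc-refl u = subst (λ w → desc u w ≡ true) (anc-ht u) (desc-anc u ≤-refl)

  desc-root : ∀ u → desc u root ≡ true
  desc-root u = subst (λ r → desc u r ≡ true) (anc-zero u) (desc-anc u z≤n)

  desc-ht-injective : ∀ {u v w} → desc u v ≡ true → desc u w ≡ true → ht v ≡ ht w → v ≡ w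
  desc-ht-injective {u} u≤v u≤w ht≡ =
    trans (sym (proj₂ (desc⇒anc u≤v))) (trans (cong (anc u) ht≡) (proj₂ (desc⇒anc u≤w)))

  leaf-childless : ∀ {v w} → isLeaf v ≡ true → w ≢ root → par w ≢ v
  leaf-childless {v} {w} leaf w≢root par≡v = contradiction (trans (sym leaf) (cong not w-child)) λ ()
    where
      w-child : anyFin (λ u → not (isRoot u) ∧ ⌊ par u ≟ v ⌋) ≡ true
      w-child = anyFin⁺ _ w (cong₂ (λ a b → not a ∧ b) (≟-≢ w≢root)
                                   (trans (cong (λ p → ⌊ p ≟ v ⌋) par≡v) (≟-refl v)))

  desc-leaf : ∀ {u v} → isLeaf v ≡ true → desc u v ≡ true → u ≡ v
  desc-leaf {u} {v} leaf u≤v with desc⇒anc u≤v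
  ... | ht-v≤ , anc-v with m≤n⇒m<n∨m≡n ht-v≤
  ...   | inj₁ ht-v< = contradiction (trans (par-anc u ht-v<) anc-v)
                         (leaf-childless leaf (anc-nonroot u (s≤s z≤n) ht-v<))
  ...   | inj₂ ht-v≡ = trans (sym (anc-ht u)) (trans (cong (anc u) (sym ht-v≡)) anc-v)

  desc-anc-anc : ∀ u {d d'} → d' ≤ d → d ≤ ht u → desc (anc u d) (anc u d') ≡ true
  desc-anc-anc u {d} {d'} d'≤d d≤ht =
    subst (λ w → desc (anc u d) w ≡ true) (anc-anc u d'≤d d≤ht)
          (desc-anc (anc u d) (subst (d' ≤_) (sym (ht-anc u d≤ht)) d'≤d))

module ObliviousSets (I : WORMS) (Pk : Packing I) (O : Oblivious I Pk) where
  open WORMS I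
  open Packing Pk
  open Oblivious O
  open TreeProperties tree

  C⇒desc : ∀ {v x} → C v x ≡ true → desc (target x) v ≡ true
  C⇒desc {v} {x} v∋x with v ≟ root
  ... | yes refl    = desc-root (target x)
  ... | no  v≢root = proj₁ (to (C-spec v v≢root x) v∋x)

  packed-contents-disjoint : ∀ {v w x} → pk v ≡ true → pk w ≡ true →
                             C v x ≡ true → C w x ≡ true → v ≡ w
  packed-contents-disjoint {v} {w} {x} pk-v pk-w v∋x w∋x with v ≟ root | w ≟ root
  ... | yes refl    | yes refl    = refl
  ... | yes refl    | no  w≢root = contradiction (w , w≢root , pk-w , w∋x) (to (C-root x) v∋x)
  ... | no  v≢root | yes refl    = contradiction (v , v≢root , pk-v , v∋x) (to (C-root x) w∋x)
  ... | no  v≢root | no  w≢root with <-cmp (ht v) (ht w)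
  ...   | tri< v<w _ _ = contradiction (w , pk-w , v<w , w∋x) (proj₂ (to (C-spec v v≢root x) v∋x))
  ...   | tri> _ _ w<v = contradiction (v , pk-v , w<v , v∋x) (proj₂ (to (C-spec w w≢root x) w∋x))
  ...   | tri≈ _ ht≡ _ = desc-ht-injective (C⇒desc v∋x) (C⇒desc w∋x) ht≡

  packed-contents-cover : ∀ x → ∃ λ v → pk v ≡ true × C v x ≡ true
  packed-contents-cover x
    with any? (λ w → ¬? (w ≟ root) ×-dec (pk w Bool.≟ true) ×-dec (C w x Bool.≟ true))
  ... | yes (w , _ , pk-w , w∋x) = w , pk-w , w∋x
  ... | no  none                 = root , pk-root , from (C-root x) (λ (w , p) → none (w , p))

  path-child : ∀ {v x} → isLeaf v ≡ false → desc (target x) v ≡ true →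
               ∃ λ c → c ≢ root × par c ≡ v × desc (target x) c ≡ true
  path-child {v} {x} internal u≤v with desc⇒anc u≤v
  ... | ht-v≤ , anc-v with m≤n⇒m<n∨m≡n ht-v≤
  ...   | inj₂ ht-v≡ = contradiction (trans (sym (target-leaf x)) (trans (cong isLeaf u≡v) internal)) λ ()
    where u≡v = trans (sym (anc-ht (target x))) (trans (cong (anc (target x)) (sym ht-v≡)) anc-v)
  ...   | inj₁ ht-v< = anc u (suc (ht v)) , anc-nonroot u (s≤s z≤n) ht-v<
                     , trans (par-anc u ht-v<) anc-v , desc-anc u ht-v<
    where u = target x

  data MemberView (k : Fin K) (x : Fin m) : Set where
    leaf-set  : isLeaf (pv k) ≡ true → lset k x ≡ true → MemberView k x
    group-set : isLeaf (pv k) ≡ false → C (pv k) x ≡ true →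
                ∀ c → grp k c ≡ true → desc (target x) c ≡ true → MemberView k x

  member-view : ∀ {k x} → member k x ≡ true → MemberView k x
  member-view {k} {x} k∋x with isLeaf (pv k) in leaf?
  ... | true  = leaf-set leaf? k∋x
  ... | false with ∧-true⁻ k∋x
  ...   | pv∋x , in-group with anyFin⁻ _ in-group
  ...     | c , c-in = group-set leaf? pv∋x c (proj₁ (∧-true⁻ c-in)) (proj₂ (∧-true⁻ c-in))

  member⇒C : ∀ {k x} → member k x ≡ true → C (pv k) x ≡ true
  member⇒C {k} {x} k∋x with member-view k∋x
  ... | leaf-set leaf ls        = lset-sub k leaf x ls
  ... | group-set _ pv∋x _ _ _ = pv∋x

  member-leaf : ∀ {k x} → isLeaf (pv k) ≡ true → member k x ≡ true → target x ≡ pv k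
  member-leaf leaf k∋x = desc-leaf leaf (C⇒desc (member⇒C k∋x))

  group-child-ht : ∀ {k c} → isLeaf (pv k) ≡ false → grp k c ≡ true → ht c ≡ suc (ht (pv k))
  group-child-ht {k} {c} internal grp-c =
    trans (ht-par c (proj₁ child)) (cong (suc ∘ ht) (proj₂ child))
    where child = grp-children k internal c grp-c

  member-unique : ∀ {k k' x} → member k x ≡ true → member k' x ≡ true → k ≡ k'
  member-unique {k} {k'} {x} k∋x k'∋x =
    same-parent (member-view k∋x) (member-view k'∋x)
      (packed-contents-disjoint (pv-packed k) (pv-packed k') (member⇒C k∋x) (member⇒C k'∋x))
    where
      same-parent : MemberView k x → MemberView k' x → pv k ≡ pv k' → k ≡ k'
      same-parent (leaf-set leaf ls) (leaf-set _ ls') same =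
        proj₂ (lset-partition (pv k) (pv-packed k) leaf x (member⇒C k∋x)) k k' refl ls (sym same) ls'
      same-parent (leaf-set leaf _) (group-set internal' _ _ _ _) same =
        contradiction (trans (sym leaf) (trans (cong isLeaf same) internal')) λ ()
      same-parent (group-set internal _ _ _ _) (leaf-set leaf' _) same =
        contradiction (trans (sym leaf') (trans (cong isLeaf (sym same)) internal)) λ ()
      same-parent (group-set internal _ c grp-c u≤c) (group-set internal' _ c' grp-c' u≤c') same =
        proj₂ (grp-partition (pv k) (pv-packed k) internal c (proj₁ child) (proj₂ child))
          k k' refl grp-c (sym same) (subst (λ d → grp k' d ≡ true) (sym c≡c') grp-c')
        where
          child = grp-children k internal c grp-c
          c≡c' = desc-ht-injective u≤c u≤c'
            (trans (group-child-ht internal grp-c)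
              (trans (cong (suc ∘ ht) same) (sym (group-child-ht internal' grp-c'))))

  member-unfold : ∀ {k x b} → isLeaf (pv k) ≡ b →
    member k x ≡ (if b then lset k x else (C (pv k) x ∧ anyFin (λ c → grp k c ∧ desc (target x) c)))
  member-unfold {k} {x} refl = refl

  member-exists : ∀ x → ∃ λ k → member k x ≡ true
  member-exists x with packed-contents-cover x
  ... | v , pk-v , v∋x with isLeaf v in leaf?
  ...   | true with proj₁ (lset-partition v pk-v leaf? x v∋x)
  ...     | k , refl , ls = k , trans (member-unfold leaf?) ls
  member-exists x | v , pk-v , v∋x | false with path-child leaf? (C⇒desc v∋x)
  ... | c , c≢root , par-c , u≤c with proj₁ (grp-partition v pk-v leaf? c c≢root par-c)
  ...   | k , refl , grp-c =
    k , trans (member-unfold leaf?) (cong₂ _∧_ v∋x (anyFin⁺ _ c (cong₂ _∧_ grp-c u≤c)))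

  setOf : Fin m → Fin K
  setOf x = proj₁ (member-exists x)

  setOf-member : ∀ x → member (setOf x) x ≡ true
  setOf-member x = proj₂ (member-exists x)

  member⇒setOf : ∀ {k x} → member k x ≡ true → k ≡ setOf x
  member⇒setOf {x = x} k∋x = member-unique k∋x (setOf-member x)

  non-member : ∀ {k x} → k ≢ setOf x → member k x ≡ false
  non-member {k} {x} k≢setOf with member k x in k∋x
  ... | true  = contradiction (member⇒setOf k∋x) k≢setOf
  ... | false = refl

  isTask-chain : ∀ {k e} → e ≢ root → desc (pv k) e ≡ true → isTask k e ≡ true
  isTask-chain e≢root pv≤e rewrite ≟-≢ e≢root | pv≤e = refl

  isTask-group : ∀ {k e} → e ≢ root → isLeaf (pv k) ≡ false →
                 anyFin (λ c → grp k c ∧ desc e c) ≡ true → isTask k e ≡ true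
  isTask-group {k} {e} e≢root internal in-group rewrite ≟-≢ e≢root | internal | in-group = ∨-zeroʳ _

  isTask⇒nonroot : ∀ {k e} → isTask k e ≡ true → e ≢ root
  isTask⇒nonroot task refl =
    contradiction (trans (sym (proj₁ (∧-true⁻ task))) (cong not (≟-refl root))) λ ()

  path-isTask : ∀ {k x d} → member k x ≡ true → 0 < d → d ≤ ht (target x) →
                isTask k (anc (target x) d) ≡ true
  path-isTask {k} {x} {d} k∋x 0<d d≤L with member-view k∋x
  ... | leaf-set leaf _ =
    isTask-chain (anc-nonroot u 0<d d≤L)
      (subst (λ v → desc v (anc u d) ≡ true) (member-leaf leaf k∋x) (desc-anc u d≤L))
    where u = target x
  ... | group-set internal pv∋x c grp-c u≤c with d ≤? ht (pv k)
  ...   | yes d≤pv =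
    isTask-chain (anc-nonroot u 0<d d≤L)
      (subst (λ v → desc v (anc u d) ≡ true) (proj₂ pv-on-path)
        (desc-anc-anc u d≤pv (proj₁ pv-on-path)))
    where u = target x
          pv-on-path = desc⇒anc (C⇒desc pv∋x)
  ...   | no  d≰pv =
    isTask-group (anc-nonroot u 0<d d≤L) internal
      (anyFin⁺ _ c (cong₂ _∧_ grp-c
        (subst (λ w → desc (anc u d) w ≡ true) (proj₂ (desc⇒anc u≤c)) (desc-anc-anc u c≤d d≤L))))
    where u = target x
          c≤d = subst (_≤ d) (sym (group-child-ht internal grp-c)) (≰⇒> d≰pv)

  ht-target>0 : ∀ x → 0 < ht (target x)
  ht-target>0 x = nonroot⇒ht>0 λ target≡root →
    contradiction (trans (sym (target-leaf x)) (trans (cong isLeaf target≡root) root-not-leaf)) λ ()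

  member-target-isTask : ∀ {k x} → member k x ≡ true → isTask k (target x) ≡ true
  member-target-isTask {k} {x} k∋x =
    subst (λ e → isTask k e ≡ true) (anc-ht (target x)) (path-isTask k∋x (ht-target>0 x) ≤-refl)

  weight-count : ∀ k e → weight k e ≡ count (λ x → member k x ∧ ⌊ target x ≟ e ⌋)
  weight-count k e = by-leafness (isLeaf (pv k)) refl
    where
      by-leafness : ∀ b → isLeaf (pv k) ≡ b →
        (if b then (if ⌊ e ≟ pv k ⌋ then count (member k) else 0)
         else (if isLeaf e then count (λ x → member k x ∧ ⌊ target x ≟ e ⌋) else 0))
        ≡ count (λ x → member k x ∧ ⌊ target x ≟ e ⌋)
      by-leafness true leaf with e ≟ pv k
      ... | yes refl = count-cong at-pv
        where
          at-pv : ∀ x → member k x ≡ member k x ∧ ⌊ target x ≟ pv k ⌋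
          at-pv x with member k x in k∋x
          ... | false = refl
          ... | true  = sym (trans (cong (λ t → ⌊ t ≟ pv k ⌋) (member-leaf leaf k∋x)) (≟-refl (pv k)))
      ... | no  e≢pv = sym (count-none _ off-pv)
        where
          off-pv : ∀ x → (member k x ∧ ⌊ target x ≟ e ⌋) ≡ false
          off-pv x with member k x in k∋x
          ... | false = refl
          ... | true  = ≟-≢ λ target≡e → e≢pv (trans (sym target≡e) (member-leaf leaf k∋x))
      by-leafness false _ with isLeaf e in leaf-e?
      ... | true  = refl
      ... | false = sym (count-none _ λ x →
        trans (cong (member k x ∧_) (≟-≢ λ target≡e →
                contradiction (trans (sym (target-leaf x)) (trans (cong isLeaf target≡e) leaf-e?)) λ ()))
              (Bool.∧-zeroʳ (member k x)))

  task-cost : ∀ k e t → (if isTask k e then weight k e * t else 0)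
                        ≡ count (λ x → member k x ∧ ⌊ target x ≟ e ⌋) * t
  task-cost k e t with isTask k e in task?
  ... | true  = cong (_* t) (weight-count k e)
  ... | false = cong (_* t) (sym (count-none _ off-path))
    where
      off-path : ∀ x → (member k x ∧ ⌊ target x ≟ e ⌋) ≡ false
      off-path x with member k x in k∋x | target x ≟ e
      ... | false | _        = refl
      ... | true  | no _     = refl
      ... | true  | yes refl = contradiction (trans (sym (member-target-isTask k∋x)) task?) λ ()

module _ (I : WORMS) where
  open WORMS I
  open DecMembership (_≟_ {m}) using (_∈?_)

  move-untouched : ∀ fs st {x} → (∀ {f} → f ∈ fs → ¬ x ∈ proj₂ f) → move I fs st x ≡ st x
  move-untouched []               st         untouched = refl
  move-untouched ((v , ms) ∷ fs) st {x} untouched with x ∈? ms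
  ... | yes x∈ms = contradiction x∈ms (untouched (here refl))
  ... | no  _    = move-untouched fs st (untouched ∘ there)

  move-into : ∀ fs st {x v} → (∀ {f} → f ∈ fs → x ∈ proj₂ f → proj₁ f ≡ v) →
              Any (λ f → x ∈ proj₂ f) fs → move I fs st x ≡ v
  move-into ((v' , ms) ∷ fs) st {x} into flushed with x ∈? ms
  ... | yes x∈ms = into (here refl) x∈ms
  ... | no  x∉ms with flushed
  ...   | here x∈ms = contradiction x∈ms x∉ms
  ...   | there rest = move-into fs st (into ∘ there) rest

module OverfillingSchedule (I : WORMS) (Pk : Packing I) (O : Oblivious I Pk)
  (σ : Fin (Oblivious.K O) → Fin (RootedTree.N (WORMS.tree I)) → ℕ)
  (feasible : Oblivious.Feasible O σ) where
  open WORMS I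
  open Packing Pk
  open Oblivious O
  open TreeProperties tree
  open ObliviousSets I Pk O

  L : Fin m → ℕ
  L x = ht (target x)

  arrival : Fin m → ℕ → ℕ
  arrival x d = σ (setOf x) (anc (target x) d)

  arrival>0 : ∀ {x d} → 0 < d → d ≤ L x → 0 < arrival x d
  arrival>0 {x} 0<d d≤L = proj₁ feasible (setOf x) _ (path-isTask (setOf-member x) 0<d d≤L)

  arrival-step : ∀ {x d} → 0 < d → d < L x → arrival x d < arrival x (suc d)
  arrival-step {x} {d} 0<d d<L =
    subst (λ e → σ (setOf x) e < arrival x (suc d)) (par-anc u d<L)
      (proj₁ (proj₂ feasible) (setOf x) (anc u (suc d)) (path-isTask (setOf-member x) (s≤s z≤n) d<L)
        (subst (_≢ root) (sym (par-anc u d<L)) (anc-nonroot u 0<d (<⇒≤ d<L))))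
    where u = target x

  arrival-mono : ∀ {x a b} → 0 < a → a < b → b ≤ L x → arrival x a < arrival x b
  arrival-mono {x} {a} {suc b} 0<a a<sb sb≤L with m≤n⇒m<n∨m≡n (s≤s⁻¹ a<sb)
  ... | inj₂ refl = arrival-step 0<a sb≤L
  ... | inj₁ a<b  = <-trans (arrival-mono 0<a a<b (<⇒≤ sb≤L)) (arrival-step (<-≤-trans 0<a (<⇒≤ a<b)) sb≤L)

  scheduledAt : ℕ → Fin K × Fin N → Bool
  scheduledAt t (k , e) = isTask k e ∧ (σ k e ≡ᵇ t)

  tasksAt : ℕ → List (Fin K × Fin N)
  tasksAt t = filterᵇ (scheduledAt t) (cartesianProduct (allFin K) (allFin N))

  ∈-tasksAt⁺ : ∀ {t k e} → isTask k e ≡ true → σ k e ≡ t → (k , e) ∈ tasksAt t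
  ∈-tasksAt⁺ {t} {k} {e} task at =
    ∈-filter⁺ (T? ∘ scheduledAt t) (∈-cartesianProduct⁺ (∈-allFin k) (∈-allFin e))
      (from T-∧ (from T-≡ task , ≡⇒≡ᵇ (σ k e) t at))

  ∈-tasksAt⁻ : ∀ {t k e} → (k , e) ∈ tasksAt t → isTask k e ≡ true × σ k e ≡ t
  ∈-tasksAt⁻ {t} {k} {e} k,e∈
    with to T-∧ (proj₂ (∈-filter⁻ (T? ∘ scheduledAt t) {xs = cartesianProduct (allFin K) (allFin N)} k,e∈))
  ... | task , at = to T-≡ task , ≡ᵇ⇒≡ (σ k e) t at

  tasksAt-unique : ∀ t → Unique (tasksAt t)
  tasksAt-unique t = filter⁺ (T? ∘ scheduledAt t) (cartesianProduct⁺ (allFin⁺ K) (allFin⁺ N))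

  inBelow : Fin K → Fin N → Fin m → Bool
  inBelow k e x = member k x ∧ desc (target x) e

  below : Fin K → Fin N → List (Fin m)
  below k e = filterᵇ (inBelow k e) (allFin m)

  ∈-below⁺ : ∀ {k e x} → member k x ≡ true → desc (target x) e ≡ true → x ∈ below k e
  ∈-below⁺ {k} {e} {x} k∋x x≤e = ∈-filter⁺ (T? ∘ inBelow k e) (∈-allFin x) (from T-≡ (cong₂ _∧_ k∋x x≤e))

  ∈-below⁻ : ∀ {k e x} → x ∈ below k e → member k x ≡ true × desc (target x) e ≡ true
  ∈-below⁻ {k} {e} x∈ = ∧-true⁻ (to T-≡ (proj₂ (∈-filter⁻ (T? ∘ inBelow k e) {xs = allFin m} x∈)))

  below-unique : ∀ k e → Unique (below k e)
  below-unique k e = filter⁺ (T? ∘ inBelow k e) (allFin⁺ m)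

  length-below : ∀ k e → length (below k e) ≤ B
  length-below k e = begin
    length (below k e)
      ≤⟨ length-mono-≤ (Sublist.filter⁺ (T? ∘ inBelow k e) (T? ∘ member k) keep (⊆-refl {x = allFin m})) ⟩
    length (filterᵇ (member k) (allFin m)) ≡⟨ length-filterᵇ (member k) (allFin m) ⟩
    count (member k)                       ≤⟨ m≤m+n (count (member k)) _ ⟩
    2 * count (member k)                   ≤⟨ size-upper k ⟩
    B                                      ∎
    where
      open ≤-Reasoning
      keep : ∀ {x y} → x ≡ y → T (inBelow k e x) → T (member k y)
      keep refl = proj₁ ∘ to T-∧

  flush : Fin K × Fin N → Flush I
  flush (k , e) = e , below k e

  step : ℕ → List (Flush I)
  step t = map flush (tasksAt t)

  steps : ℕ → ℕ → Schedule I
  steps t zero    = []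
  steps t (suc n) = step t ∷ steps (suc t) n

  record HeightAfter (s : ℕ) (x : Fin m) (d : ℕ) : Set where
    field
      d≤L     : d ≤ L x
      passed  : ∀ {d'} → 0 < d' → d' ≤ d → arrival x d' ≤ s
      pending : ∀ {d'} → d < d' → d' ≤ L x → s < arrival x d'
  open HeightAfter

  arrival-next : ∀ {s x d d'} → HeightAfter s x d → 0 < d' → d' ≤ L x →
                 arrival x d' ≡ suc s → d' ≡ suc d
  arrival-next {s} {x} {d} {d'} h 0<d' d'≤L at with <-cmp d' (suc d)
  ... | tri≈ _ d'≡ _ = d'≡
  ... | tri< d'< _ _ = contradiction (subst (_≤ s) at (passed h 0<d' (s≤s⁻¹ d'<))) (1+n≰n)
  ... | tri> _ _ d'> = contradiction (subst (arrival x (suc d) <_) at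
                                      (arrival-mono (s≤s z≤n) d'> d'≤L))
                                     (<⇒≱ (s≤s (pending h ≤-refl (<⇒≤ (<-≤-trans d'> d'≤L)))))

  flushed-edge : ∀ {s x d k e} → HeightAfter s x d → (k , e) ∈ tasksAt (suc s) → x ∈ below k e →
                 k ≡ setOf x × d < L x × e ≡ anc (target x) (suc d)
  flushed-edge {s} {x} {d} {k} {e} h k,e∈ x∈ with ∈-tasksAt⁻ k,e∈ | ∈-below⁻ {k} {e} x∈
  ... | task , at | k∋x , u≤e with member⇒setOf k∋x
  ... | refl = refl , subst (_≤ L x) ht-e≡ (proj₁ e-on-path)
             , trans (sym (proj₂ e-on-path)) (cong (anc (target x)) ht-e≡)
    where
      e-on-path = desc⇒anc u≤e
      ht-e≡ : ht e ≡ suc d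
      ht-e≡ = arrival-next h (nonroot⇒ht>0 (isTask⇒nonroot task)) (proj₁ e-on-path)
                (trans (cong (σ k) (proj₂ e-on-path)) at)

  descend : ∀ {s x d} → HeightAfter s x d → d < L x → arrival x (suc d) ≡ suc s →
            HeightAfter (suc s) x (suc d)
  descend {s} {x} {d} h d<L at = record
    { d≤L     = d<L
    ; passed  = passed′
    ; pending = λ {d'} sd<d' d'≤L → subst (_< arrival x d') at (arrival-mono (s≤s z≤n) sd<d' d'≤L)
    }
    where
      passed′ : ∀ {d'} → 0 < d' → d' ≤ suc d → arrival x d' ≤ suc s
      passed′ 0<d' d'≤sd with m≤n⇒m<n∨m≡n d'≤sd
      ... | inj₂ refl = ≤-reflexive at
      ... | inj₁ d'<sd = m≤n⇒m≤1+n (passed h 0<d' (s≤s⁻¹ d'<sd))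

  stay : ∀ {s x d} → HeightAfter s x d → ¬ (d < L x × arrival x (suc d) ≡ suc s) →
         HeightAfter (suc s) x d
  stay {s} {x} {d} h no-descent = record
    { d≤L     = d≤L h
    ; passed  = λ 0<d' d'≤d → m≤n⇒m≤1+n (passed h 0<d' d'≤d)
    ; pending = λ d<d' d'≤L → ≤∧≢⇒< (pending h d<d' d'≤L) (not-now d<d' d'≤L ∘ sym)
    }
    where
      not-now : ∀ {d'} → d < d' → d' ≤ L x → arrival x d' ≢ suc s
      not-now {d'} d<d' d'≤L at with arrival-next h (<-≤-trans (s≤s z≤n) d<d') d'≤L at
      ... | refl = no-descent (d'≤L , at)

  Positions : ℕ → (Fin m → Fin N) → Set
  Positions s pos = ∀ x → ∃ λ d → HeightAfter s x d × pos x ≡ anc (target x) d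

  moved : ∀ {s x d} pos → HeightAfter s x d → d < L x → arrival x (suc d) ≡ suc s →
          move I (step (suc s)) pos x ≡ anc (target x) (suc d)
  moved {s} {x} {d} pos h d<L at = move-into I (step (suc s)) pos into
    (lose (∈-map⁺ flush (∈-tasksAt⁺ (path-isTask (setOf-member x) (s≤s z≤n) d<L) at))
          (∈-below⁺ (setOf-member x) (desc-anc (target x) d<L)))
    where
      into : ∀ {f} → f ∈ step (suc s) → x ∈ proj₂ f → proj₁ f ≡ anc (target x) (suc d)
      into f∈ x∈ with ∈-map⁻ flush f∈
      ... | _ , k,e∈ , refl = proj₂ (proj₂ (flushed-edge h k,e∈ x∈))

  unmoved : ∀ {s x d} pos → HeightAfter s x d → ¬ (d < L x × arrival x (suc d) ≡ suc s) →
            move I (step (suc s)) pos x ≡ pos x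
  unmoved {s} {x} {d} pos h no-descent = move-untouched I (step (suc s)) pos untouched
    where
      untouched : ∀ {f} → f ∈ step (suc s) → ¬ x ∈ proj₂ f
      untouched f∈ x∈ with ∈-map⁻ flush f∈
      ... | _ , k,e∈ , refl with flushed-edge h k,e∈ x∈
      ...   | refl , d<L , refl = no-descent (d<L , proj₂ (∈-tasksAt⁻ k,e∈))

  positions-step : ∀ {s pos} → Positions s pos → Positions (suc s) (move I (step (suc s)) pos)
  positions-step {s} {pos} at-s x with at-s x
  ... | d , h , pos-x with (d <? L x) ×-dec (arrival x (suc d) ≟ℕ suc s)
  ...   | yes (d<L , at) = suc d , descend h d<L at , moved pos h d<L at
  ...   | no  no-descent = d , stay h no-descent , trans (unmoved pos h no-descent) pos-x

  step-valid : ∀ {s pos} → Positions s pos → StepValid I pos (step (suc s))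
  step-valid {s} {pos} at-s = capacity , disjoint , map⁺ (All.tabulate flush-valid)
    where
      tasks = tasksAt (suc s)

      capacity : length (step (suc s)) ≤ P
      capacity = begin
        length (map flush tasks)
          ≡⟨ length-map flush tasks ⟩
        length tasks
          ≡⟨ count-pairs (λ k e → scheduledAt (suc s) (k , e)) ⟩
        sumFin (λ k → count (λ e → isTask k e ∧ (σ k e ≡ᵇ suc s)))
          ≤⟨ proj₂ (proj₂ feasible) (suc s) ⟩
        P ∎
        where open ≤-Reasoning

      owner : ∀ {a b y} → a ∈ tasks → b ∈ tasks → y ∈ below (proj₁ a) (proj₂ a) →
              y ∈ below (proj₁ b) (proj₂ b) → a ≡ b
      owner {y = y} a∈ b∈ y∈a y∈b with at-s y
      ... | d , h , _ with flushed-edge h a∈ y∈a | flushed-edge h b∈ y∈b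
      ...   | refl , _ , refl | refl , _ , refl = refl

      disjoint : Unique (concatMap proj₂ (step (suc s)))
      disjoint = subst Unique (cong concat (map-∘ tasks))
        (concatMap-unique (λ (k , e) → below k e) (tasksAt-unique (suc s))
          (λ {(k , e)} _ → below-unique k e) owner)

      flush-valid : ∀ {(k , e) : Fin K × Fin N} → (k , e) ∈ tasks →
                    e ≢ root × length (below k e) ≤ B × All (λ x → pos x ≡ par e) (below k e)
      flush-valid {k , e} k,e∈ = isTask⇒nonroot (proj₁ (∈-tasksAt⁻ k,e∈)) , length-below k e
                               , All.tabulate at-parent
        where
          at-parent : ∀ {x} → x ∈ below k e → pos x ≡ par e
          at-parent {x} x∈ with at-s x
          ... | d , h , pos-x with flushed-edge h k,e∈ x∈
          ...   | _ , d<L , refl = trans pos-x (sym (par-anc (target x) d<L))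

  initial-positions : Positions 0 (λ _ → root)
  initial-positions x = 0 , h , sym (anc-zero (target x))
    where
      h : HeightAfter 0 x 0
      h = record
        { d≤L     = z≤n
        ; passed  = λ 0<d' d'≤0 → contradiction (<-≤-trans 0<d' d'≤0) λ ()
        ; pending = arrival>0
        }

  steps-valid : ∀ n {s pos} → Positions s pos → ValidFrom I pos (steps (suc s) n)
  steps-valid zero    at-s = _
  steps-valid (suc n) at-s = step-valid at-s , steps-valid n (positions-step at-s)

  completion : Fin m → ℕ
  completion x = σ (setOf x) (target x)

  target-task : ∀ x → isTask (setOf x) (target x) ≡ true
  target-task x = member-target-isTask (setOf-member x)

  -- Any bound on all completion times would do; the sum avoids taking a maximum.
  horizon : ℕ
  horizon = sumFin completion

  schedule : Schedule I
  schedule = steps 1 horizon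

  IntoTarget : Fin m → Flush I → Set
  IntoTarget x (v , ms) = x ∈ ms × v ≡ target x

  steps-flushed : ∀ {x} s n j → j < n → Any (IntoTarget x) (step (s + j)) →
                  FlushedIntoTarget I (steps s n) x (suc j)
  steps-flushed {x} s (suc n) zero    _         into = subst (Any (IntoTarget x) ∘ step) (+-identityʳ s) into
  steps-flushed {x} s (suc n) (suc j) (s≤s j<n) into =
    steps-flushed (suc s) n j j<n (subst (Any (IntoTarget x) ∘ step) (+-suc s j) into)

  completion-flushed : ∀ x → FlushedIntoTarget I schedule x (completion x)
  -- Feasibility makes completion x positive, which rules out the case completion x = 0.
  completion-flushed x with completion x in at | proj₁ feasible (setOf x) (target x) (target-task x)
  ... | suc j | _ = steps-flushed 1 horizon j (subst (_≤ horizon) at (≤-sumFin completion x))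
    (lose (∈-map⁺ flush (∈-tasksAt⁺ (target-task x) at))
          (∈-below⁺ (setOf-member x) (desc-refl (target x)) , refl))

  lands : Fin K → Fin N → Fin m → ℕ
  lands k e x = if member k x ∧ ⌊ target x ≟ e ⌋ then 1 else 0

  completion-as-sum : ∀ x → ∑[ k < K ] ∑[ e < N ] (lands k e x * σ k e) ≡ completion x
  completion-as-sum x = begin
    ∑[ k < K ] ∑[ e < N ] (lands k e x * σ k e)
      ≡⟨ ∑-single _ (setOf x) other-set ⟩
    ∑[ e < N ] (lands (setOf x) e x * σ (setOf x) e)
      ≡⟨ ∑-single _ (target x) other-edge ⟩
    lands (setOf x) (target x) x * completion x
      ≡⟨ cong (λ b → (if b then 1 else 0) * completion x) (cong₂ _∧_ (setOf-member x) (≟-refl (target x))) ⟩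
    1 * completion x
      ≡⟨ *-identityˡ (completion x) ⟩
    completion x ∎
    where
      open ≡-Reasoning
      other-set : ∀ k → k ≢ setOf x → ∑[ e < N ] (lands k e x * σ k e) ≡ 0
      other-set k k≢ = trans
        (sum-cong-≗ λ e → cong (λ b → (if b ∧ ⌊ target x ≟ e ⌋ then 1 else 0) * σ k e) (non-member k≢))
        (sum-replicate-zero N)
      other-edge : ∀ e → e ≢ target x → lands (setOf x) e x * σ (setOf x) e ≡ 0
      other-edge e e≢ = cong (λ b → (if b then 1 else 0) * σ (setOf x) e)
        (trans (cong (member (setOf x) x ∧_) (≟-≢ (e≢ ∘ sym))) (Bool.∧-zeroʳ _))

  count-lands : ∀ k e t → count (λ x → member k x ∧ ⌊ target x ≟ e ⌋) * t ≡ ∑[ x < m ] (lands k e x * t)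
  count-lands k e t = trans (cong (_* t) (sumFin≡∑ (lands k e))) (*-distribʳ-sum t (lands k e))

  cost-term : Fin K → Fin N → ℕ
  cost-term k e = if isTask k e then weight k e * σ k e else 0

  horizon≡cost : horizon ≡ cost σ
  horizon≡cost = begin
    sumFin completion
      ≡⟨ sumFin≡∑ completion ⟩
    ∑[ x < m ] completion x
      ≡⟨ sum-cong-≗ (sym ∘ completion-as-sum) ⟩
    ∑[ x < m ] ∑[ k < K ] ∑[ e < N ] (lands k e x * σ k e)
      ≡⟨ ∑-comm (λ x k → ∑[ e < N ] (lands k e x * σ k e)) ⟩
    ∑[ k < K ] ∑[ x < m ] ∑[ e < N ] (lands k e x * σ k e)
      ≡⟨ sum-cong-≗ (λ k → ∑-comm (λ x e → lands k e x * σ k e)) ⟩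
    ∑[ k < K ] ∑[ e < N ] ∑[ x < m ] (lands k e x * σ k e)
      ≡⟨ sum-cong-≗ (λ k → sum-cong-≗ λ e → sym (trans (task-cost k e (σ k e)) (count-lands k e (σ k e)))) ⟩
    ∑[ k < K ] ∑[ e < N ] cost-term k e
      ≡⟨ sum-cong-≗ (λ k → sumFin≡∑ (cost-term k)) ⟨
    ∑[ k < K ] sumFin (cost-term k)
      ≡⟨ sumFin≡∑ (λ k → sumFin (cost-term k)) ⟨
    cost σ ∎
    where open ≡-Reasoning

lemma7 : (I : WORMS) (Pk : Packing I) (O : Oblivious I Pk)
         (σ : Fin (Oblivious.K O) → Fin (RootedTree.N (WORMS.tree I)) → ℕ) →
         Oblivious.Feasible O σ →
         ∃ λ (S' : Schedule I) → Overfilling I S' × ScheduleCost I S' (Oblivious.cost O σ)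
lemma7 I Pk O σ feasible =
  schedule , (steps-valid horizon initial-positions , λ x → completion x , completion-flushed x)
           , (completion , completion-flushed , horizon≡cost)
  where open OverfillingSchedule I Pk O σ feasible
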